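{- Let $m,d$ be positive integers with $m^2\le d$. Let $U$ be a subset of $\mathcal{F}_m\setminus\{1\}$, and for $P/Q\in\mathcal{F}_m\setminus\{1\}$ let $P'/Q'$ denote the element of $\mathcal{F}_m$ immediately following $P/Q$. Then \[ \sum_{P/Q\in U}\#\left\{a\in\mathbb{Z}_d^*:\ \frac{P}{Q}<\frac{a}{d}<\frac{P'}{Q'}\right\}\le 2d\cdot\lambda\!\left(\bigcup_{P/Q\in U}\left[\frac{P}{Q},\frac{P'}{Q'}\right]\right). \]
   Context: $\mathcal{F}_m$ is the set of fractions in $[0,1]$ whose denominator in lowest terms is at most $m$, ordered by $<$; two elements are consecutive if no element of $\mathcal{F}_m$ lies strictly between them. $\mathbb{Z}_d^*$ is the set of integers in $[1,d]$ relatively prime to $d$. $\lambda$ is Lebesgue measure. -}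

module Defs where

open import Data.Nat as ℕ using (ℕ; zero; suc)
open import Data.Nat.Coprimality using (Coprime; coprime?)
open import Data.Integer using (+_)
open import Data.Rational as ℚ using (ℚ; 0ℚ; 1ℚ; ↧ₙ_; _<?_; _≤?_)
open import Data.List using (List; []; _∷_; map; filter; upTo; length)
open import Data.Nat.ListAction using (product)
open import Data.List.Relation.Unary.Any using (Any)
open import Data.List.Relation.Unary.Any.Properties using ()
import Data.List.Relation.Unary.Any as Any
open import Data.Product using (_×_; _,_; proj₁; proj₂)
open import Relation.Nullary using (¬_)
open import Relation.Nullary.Decidable using (_×-dec_)
open import Relation.Binary.PropositionalEquality using (_≢_)

-- the rational a / d (d = 0 is never used; we return 0 there)
_÷_ : ℕ → ℕ → ℚ
a ÷ zero = 0ℚ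
a ÷ suc n = (+ a) ℚ./ suc n

-- x ∈ 𝓕_m : a fraction in [0,1] whose denominator in lowest terms is ≤ m
-- (elements of Data.Rational.ℚ are always in lowest terms)
InFarey : ℕ → ℚ → Set
InFarey m x = (0ℚ ℚ.≤ x) × (x ℚ.≤ 1ℚ) × (↧ₙ x ℕ.≤ m)

IsFareySuccessor : ℕ → (ℚ → ℚ) → Set
IsFareySuccessor m nxt =
  ∀ x → InFarey m x → x ≢ 1ℚ →
    InFarey m (nxt x) × (x ℚ.< nxt x) ×
    (∀ y → InFarey m y → x ℚ.< y → ¬ (y ℚ.< nxt x))

countUnits : ℕ → ℚ → ℚ → ℕ
countUnits d x y =
  length (filter (λ a → coprime? a d ×-dec ((x <? (a ÷ d)) ×-dec ((a ÷ d) <? y)))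
                 (map suc (upTo d)))

-- Lebesgue measure of a finite union of closed intervals [lo,hi] with rational
-- endpoints contained in [0,1]. With N the product of all endpoint denominators,
-- every endpoint lies on the grid (1/N)ℤ, so the union equals (up to a null set)
-- the union of those grid cells [k/N,(k+1)/N], 0 ≤ k < N, whose midpoint
-- (2k+1)/(2N) lies in the union; the measure is (number of such cells)/N.
gridSize : List (ℚ × ℚ) → ℕ
gridSize ivs = product (map (λ iv → ↧ₙ proj₁ iv ℕ.* ↧ₙ proj₂ iv) ivs)

measureUnion : List (ℚ × ℚ) → ℚ
measureUnion ivs =
  length (filter (λ k → Any.any? (λ iv → (proj₁ iv ≤? mid k) ×-dec (mid k ≤? proj₂ iv)) ivs)
                 (upTo N)) ÷ N
  where
  N : ℕ
  N = gridSize ivs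
  mid : ℕ → ℚ
  mid k = suc (2 ℕ.* k) ÷ (2 ℕ.* N)

-- Let N be the product of the denominators of all endpoints x, nxt x (x ∈ U). Every endpoint
-- is then k/N for a natural k, and measureUnion counts the cells [k/N, (k+1)/N] whose midpoint
-- lies in the union. If x = p/q < nxt x = p'/q' are consecutive in 𝓕ₘ, then
-- nxt x − x ≥ 1/(qq') ≥ 1/m² ≥ 1/d, so the open interval (x, nxt x) contains at most
-- d (nxt x − x) + 1 ≤ 2d (nxt x − x) fractions a/d. Distinct x ∈ U give intervals [x, nxt x]
-- with disjoint interiors, each made of N (nxt x − x) cells. Multiplying through by N turns
-- every step into an inequality between naturals.

module Submission where

open import Defs
open import Data.Nat as ℕ using (ℕ; zero; suc; NonZero; >-nonZero; z≤n; s≤s; _≤_; _<_; _+_; _*_; _∸_)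
open import Data.Nat.Properties hiding (_<?_; _≤?_)
open import Data.Nat.Divisibility using (_∣_; ∣-trans; m∣m*n; n∣m*n; 1∣_)
open import Data.Nat.DivMod using (_/_; m/n*n≡m; n/1≡n)
open import Data.Nat.Coprimality using (coprime?)
open import Data.Nat.ListAction using (sum)
open import Data.Nat.ListAction.Properties using (∈⇒∣product; product≢0)
open import Data.Integer as ℤ using (+_)
import Data.Integer.Properties as ℤP
open import Data.Rational as ℚ using (ℚ; 0ℚ; 1ℚ; mkℚ; ↥_; ↧ₙ_; toℚᵘ; _<?_; _≤?_)
import Data.Rational.Properties as ℚP
open import Data.Rational.Unnormalised as ℚᵘ using (mkℚᵘ; *≤*; *<*; *≡*)
import Data.Rational.Unnormalised.Properties as ℚᵘP
open import Data.List using (List; []; _∷_; map; filter; upTo; length)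
open import Data.List.Properties using (filter-some)
open import Data.List.Relation.Unary.All as All using (All; []; _∷_)
import Data.List.Relation.Unary.All.Properties as AllP
open import Data.List.Relation.Unary.AllPairs using (AllPairs; []; _∷_)
import Data.List.Relation.Unary.AllPairs.Properties as AllPairsP
open import Data.List.Relation.Unary.Any as Any using (Any)
open import Data.List.Relation.Unary.Unique.Propositional using (Unique)
open import Data.List.Membership.Propositional using (_∈_; lose)
open import Data.List.Membership.Propositional.Properties using (∈-map⁺; ∈-upTo⁺)
open import Data.Product using (_×_; _,_; proj₁; proj₂)
open import Data.Sum using (_⊎_; inj₁; inj₂)
open import Data.Empty using (⊥-elim)
open import Level using (0ℓ)
open import Relation.Nullary using (¬_; yes; no)
open import Relation.Nullary.Decidable using (_×-dec_; ¬?)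
open import Relation.Unary using (Pred; Decidable; _⊆_; _⊥_)
open import Relation.Binary.Definitions using (tri<; tri≈; tri>)
open import Relation.Binary.PropositionalEquality

toℚᵘ-÷ : ∀ u v → toℚᵘ (u ÷ suc v) ℚᵘ.≃ mkℚᵘ (+ u) v
toℚᵘ-÷ u v = ℚP.toℚᵘ-fromℚᵘ (mkℚᵘ (+ u) v)

cross-≤⇒÷-≤ : ∀ {u v u' v'} .{{_ : NonZero v}} .{{_ : NonZero v'}} →
              u * v' ≤ u' * v → u ÷ v ℚ.≤ u' ÷ v'
cross-≤⇒÷-≤ {u} {suc v} {u'} {suc v'} uv'≤u'v = ℚP.toℚᵘ-cancel-≤ (begin
  toℚᵘ (u ÷ suc v)    ≃⟨ toℚᵘ-÷ u v ⟩
  mkℚᵘ (+ u) v        ≤⟨ *≤* (subst₂ ℤ._≤_ (ℤP.pos-* u (suc v')) (ℤP.pos-* u' (suc v))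
                                     (ℤ.+≤+ uv'≤u'v)) ⟩
  mkℚᵘ (+ u') v'      ≃⟨ toℚᵘ-÷ u' v' ⟨
  toℚᵘ (u' ÷ suc v')  ∎)
  where open ℚᵘP.≤-Reasoning

cross-<⇒÷-< : ∀ {u v u' v'} .{{_ : NonZero v}} .{{_ : NonZero v'}} →
              u * v' < u' * v → u ÷ v ℚ.< u' ÷ v'
cross-<⇒÷-< {u} {suc v} {u'} {suc v'} uv'<u'v = ℚP.toℚᵘ-cancel-< (begin-strict
  toℚᵘ (u ÷ suc v)    ≃⟨ toℚᵘ-÷ u v ⟩
  mkℚᵘ (+ u) v        <⟨ *<* (subst₂ ℤ._<_ (ℤP.pos-* u (suc v')) (ℤP.pos-* u' (suc v))
                                     (ℤ.+<+ uv'<u'v)) ⟩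
  mkℚᵘ (+ u') v'      ≃⟨ toℚᵘ-÷ u' v' ⟨
  toℚᵘ (u' ÷ suc v')  ∎)
  where open ℚᵘP.≤-Reasoning

÷-≤⇒cross-≤ : ∀ {u v u' v'} .{{_ : NonZero v}} .{{_ : NonZero v'}} →
              u ÷ v ℚ.≤ u' ÷ v' → u * v' ≤ u' * v
÷-≤⇒cross-≤ x≤y = ≮⇒≥ (λ y<x → ℚP.<-irrefl refl (ℚP.<-≤-trans (cross-<⇒÷-< y<x) x≤y))

÷-<⇒cross-< : ∀ {u v u' v'} .{{_ : NonZero v}} .{{_ : NonZero v'}} →
              u ÷ v ℚ.< u' ÷ v' → u * v' < u' * v
÷-<⇒cross-< x<y = ≰⇒> (λ y≤x → ℚP.<-irrefl refl (ℚP.<-≤-trans x<y (cross-≤⇒÷-≤ y≤x)))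

cross-≡⇒÷-≡ : ∀ {u v u' v'} .{{_ : NonZero v}} .{{_ : NonZero v'}} →
              u * v' ≡ u' * v → u ÷ v ≡ u' ÷ v'
cross-≡⇒÷-≡ eq =
  ℚP.≤-antisym (cross-≤⇒÷-≤ (≤-reflexive eq)) (cross-≤⇒÷-≤ (≤-reflexive (sym eq)))

÷1-*-÷ : ∀ a b n .{{_ : NonZero n}} → (a ÷ 1) ℚ.* (b ÷ n) ≡ (a * b) ÷ n
÷1-*-÷ a b (suc n) = ℚP.toℚᵘ-injective (begin
  toℚᵘ ((a ÷ 1) ℚ.* (b ÷ suc n))          ≈⟨ ℚP.toℚᵘ-homo-* (a ÷ 1) (b ÷ suc n) ⟩
  toℚᵘ (a ÷ 1) ℚᵘ.* toℚᵘ (b ÷ suc n)     ≈⟨ ℚᵘP.*-cong (toℚᵘ-÷ a 0) (toℚᵘ-÷ b n) ⟩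
  mkℚᵘ (+ a) 0 ℚᵘ.* mkℚᵘ (+ b) n         ≈⟨ *≡* (cong₂ ℤ._*_ (sym (ℤP.pos-* a b))
                                                           (cong +_ (sym (*-identityˡ (suc n))))) ⟩
  mkℚᵘ (+ (a * b)) n                      ≈⟨ toℚᵘ-÷ (a * b) n ⟨
  toℚᵘ ((a * b) ÷ suc n)                  ∎)
  where open ℚᵘP.≃-Reasoning

nonNeg⇒≡∣↥∣÷↧ : ∀ e → 0ℚ ℚ.≤ e → e ≡ ℤ.∣ ↥ e ∣ ÷ (↧ₙ e)
nonNeg⇒≡∣↥∣÷↧ e@(mkℚ (+ _) _ _) _ = sym (ℚP.↥p/↧p≡p e)
nonNeg⇒≡∣↥∣÷↧ (mkℚ ℤ.-[1+ _ ] _ _) (ℚ.*≤* ())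

*÷*-cancelˡ : ∀ c a n .{{_ : NonZero c}} .{{_ : NonZero n}} → (c * a) ÷ (c * n) ≡ a ÷ n
*÷*-cancelˡ c a n = cross-≡⇒÷-≡ {{m*n≢0 c n}} (trans (cong (_* n) (*-comm c a)) (*-assoc a c n))

÷-monoˡ-≤ : ∀ {a b} n .{{_ : NonZero n}} → a ≤ b → a ÷ n ℚ.≤ b ÷ n
÷-monoˡ-≤ n a≤b = cross-≤⇒÷-≤ (*-monoˡ-≤ n a≤b)

module Grid (N : ℕ) .{{N≢0 : NonZero N}} where

  numerAt : ℚ → ℕ
  numerAt e = ℤ.∣ ↥ e ∣ * (N / ↧ₙ e)

  OnGrid : ℚ → Set
  OnGrid e = 0ℚ ℚ.≤ e × ↧ₙ e ∣ N

  midpoint : ℕ → ℚ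
  midpoint k = suc (2 * k) ÷ (2 * N)

  private instance
    2N≢0 : NonZero (2 * N)
    2N≢0 = m*n≢0 2 N

  numerAt-*-↧ : ∀ e → ↧ₙ e ∣ N → numerAt e * ↧ₙ e ≡ ℤ.∣ ↥ e ∣ * N
  numerAt-*-↧ e ↧e∣N =
    trans (*-assoc ℤ.∣ ↥ e ∣ (N / ↧ₙ e) (↧ₙ e)) (cong (ℤ.∣ ↥ e ∣ *_) (m/n*n≡m ↧e∣N))

  ≡numerAt÷N : ∀ {e} → OnGrid e → e ≡ numerAt e ÷ N
  ≡numerAt÷N {e} (0≤e , ↧e∣N) =
    trans (nonNeg⇒≡∣↥∣÷↧ e 0≤e) (cross-≡⇒÷-≡ {ℤ.∣ ↥ e ∣} {↧ₙ e} (sym (numerAt-*-↧ e ↧e∣N)))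

  numerAt-*-↧*↧ : ∀ e e' → ↧ₙ e ∣ N → numerAt e * (↧ₙ e * ↧ₙ e') ≡ N * (ℤ.∣ ↥ e ∣ * ↧ₙ e')
  numerAt-*-↧*↧ e e' ↧e∣N = begin
    numerAt e * (↧ₙ e * ↧ₙ e')     ≡⟨ *-assoc (numerAt e) (↧ₙ e) (↧ₙ e') ⟨
    numerAt e * ↧ₙ e * ↧ₙ e'       ≡⟨ cong (_* ↧ₙ e') (numerAt-*-↧ e ↧e∣N) ⟩
    ℤ.∣ ↥ e ∣ * N * ↧ₙ e'          ≡⟨ cong (_* ↧ₙ e') (*-comm ℤ.∣ ↥ e ∣ N) ⟩
    N * ℤ.∣ ↥ e ∣ * ↧ₙ e'          ≡⟨ *-assoc N ℤ.∣ ↥ e ∣ (↧ₙ e') ⟩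
    N * (ℤ.∣ ↥ e ∣ * ↧ₙ e')        ∎
    where open ≡-Reasoning

  numerAt-1ℚ : numerAt 1ℚ ≡ N
  numerAt-1ℚ = trans (*-identityˡ (N / 1)) (n/1≡n N)

  numerAt-mono-≤ : ∀ {x y} → OnGrid x → OnGrid y → x ℚ.≤ y → numerAt x ≤ numerAt y
  numerAt-mono-≤ x∈G y∈G x≤y = *-cancelʳ-≤ _ _ N
    (÷-≤⇒cross-≤ (subst₂ ℚ._≤_ (≡numerAt÷N x∈G) (≡numerAt÷N y∈G) x≤y))

  numerAt-gap : ∀ {x y} → OnGrid x → OnGrid y → x ℚ.< y →
                N ≤ (numerAt y ∸ numerAt x) * (↧ₙ x * ↧ₙ y)
  numerAt-gap {x} {y} (0≤x , ↧x∣N) (0≤y , ↧y∣N) x<y = begin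
    N                                           ≡⟨ *-identityʳ N ⟨
    N * 1                                       ≤⟨ *-monoʳ-≤ N (m<n⇒0<n∸m pq'<p'q) ⟩
    N * (p' * q ∸ p * q')                       ≡⟨ *-distribˡ-∸ N (p' * q) (p * q') ⟩
    N * (p' * q) ∸ N * (p * q')                 ≡⟨ cong₂ _∸_ gy*qq' gx*qq' ⟨
    numerAt y * (q * q') ∸ numerAt x * (q * q') ≡⟨ *-distribʳ-∸ (q * q') (numerAt y) (numerAt x) ⟨
    (numerAt y ∸ numerAt x) * (q * q')          ∎
    where
    open ≤-Reasoning
    p = ℤ.∣ ↥ x ∣
    q = ↧ₙ x
    p' = ℤ.∣ ↥ y ∣
    q' = ↧ₙ y
    pq'<p'q : p * q' < p' * q
    pq'<p'q = ÷-<⇒cross-< {p} {q} {p'} {q'}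
      (subst₂ ℚ._<_ (nonNeg⇒≡∣↥∣÷↧ x 0≤x) (nonNeg⇒≡∣↥∣÷↧ y 0≤y) x<y)
    gx*qq' : numerAt x * (q * q') ≡ N * (p * q')
    gx*qq' = numerAt-*-↧*↧ x y ↧x∣N
    gy*qq' : numerAt y * (q * q') ≡ N * (p' * q)
    gy*qq' = trans (cong (numerAt y *_) (*-comm q q')) (numerAt-*-↧*↧ y x ↧y∣N)

  ≤-midpoint : ∀ {x k} → OnGrid x → numerAt x ≤ k → x ℚ.≤ midpoint k
  ≤-midpoint {x} {k} x∈G gx≤k = begin
    x                         ≡⟨ ≡numerAt÷N x∈G ⟩
    numerAt x ÷ N             ≡⟨ *÷*-cancelˡ 2 (numerAt x) N ⟨
    (2 * numerAt x) ÷ (2 * N) ≤⟨ ÷-monoˡ-≤ (2 * N) (m≤n⇒m≤1+n (*-monoʳ-≤ 2 gx≤k)) ⟩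
    midpoint k                ∎
    where open ℚP.≤-Reasoning

  midpoint-≤ : ∀ {y k} → OnGrid y → k < numerAt y → midpoint k ℚ.≤ y
  midpoint-≤ {y} {k} y∈G k<gy = begin
    midpoint k                ≤⟨ ÷-monoˡ-≤ (2 * N) (*-monoʳ-< 2 k<gy) ⟩
    (2 * numerAt y) ÷ (2 * N) ≡⟨ *÷*-cancelˡ 2 (numerAt y) N ⟩
    numerAt y ÷ N             ≡⟨ ≡numerAt÷N y∈G ⟨
    y                         ∎
    where open ℚP.≤-Reasoning

module _ {A : Set} {P Q R : Pred A 0ℓ} (P? : Decidable P) (Q? : Decidable Q) (R? : Decidable R) where

  length-filter-disjoint-≤ : Q ⊆ P → R ⊆ P → Q ⊥ R → ∀ xs →
                             length (filter Q? xs) + length (filter R? xs) ≤ length (filter P? xs)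
  length-filter-disjoint-≤ Q⊆P R⊆P Q⊥R [] = z≤n
  length-filter-disjoint-≤ Q⊆P R⊆P Q⊥R (x ∷ xs)
    with ih ← length-filter-disjoint-≤ Q⊆P R⊆P Q⊥R xs | Q? x | R? x | P? x
  ... | yes q | yes r | _     = ⊥-elim (Q⊥R (q , r))
  ... | yes q | no _  | no ¬p = ⊥-elim (¬p (Q⊆P q))
  ... | no _  | yes r | no ¬p = ⊥-elim (¬p (R⊆P r))
  ... | yes _ | no _  | yes _ = s≤s ih
  ... | no _  | yes _ | yes _ = ≤-trans (≤-reflexive (+-suc _ _)) (s≤s ih)
  ... | no _  | no _  | yes _ = m≤n⇒m≤1+n ih
  ... | no _  | no _  | no _  = ih

interval-≤-length-filter : ∀ {Q : Pred ℕ 0ℓ} (Q? : Decidable Q) {N} i j → j ≤ N →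
                           (∀ {k} → i ≤ k → k < j → Q k) → j ∸ i ≤ length (filter Q? (upTo N))
interval-≤-length-filter Q? i zero _ _ = ≤-trans (≤-reflexive (0∸n≡0 i)) z≤n
interval-≤-length-filter Q? {N} i (suc j) j<N between⇒Q with i ℕ.≤? j
... | no i≰j = ≤-trans (≤-reflexive (m≤n⇒m∸n≡0 (≰⇒> i≰j))) z≤n
... | yes i≤j = begin
  suc j ∸ i                                                         ≡⟨ +-∸-assoc 1 i≤j ⟩
  suc (j ∸ i)                                                       ≡⟨ +-comm 1 (j ∸ i) ⟩
  j ∸ i + 1                                                         ≤⟨ +-mono-≤ count-below-j count-j ⟩
  length (filter In? (upTo N)) + length (filter (j ℕ.≟_) (upTo N))  ≤⟨ split ⟩
  length (filter Q? (upTo N))                                       ∎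
  where
  open ≤-Reasoning
  In? = λ k → (i ℕ.≤? k) ×-dec (k ℕ.<? j)
  count-below-j = interval-≤-length-filter In? i j (<⇒≤ j<N) _,_
  count-j = filter-some (j ℕ.≟_) (∈-upTo⁺ j<N)
  split = length-filter-disjoint-≤ Q? In? (j ℕ.≟_)
    (λ (i≤k , k<j) → between⇒Q i≤k (m≤n⇒m≤1+n k<j))
    (λ { refl → between⇒Q i≤j ≤-refl })
    (λ { ((_ , k<j) , refl) → <-irrefl refl k<j })
    (upTo N)

sum-widths-≤-length-filter :
  ∀ {A : Set} (lo hi : A → ℕ) {P : Pred ℕ 0ℓ} (P? : Decidable P) {N} xs →
  AllPairs (λ x y → hi x ≤ lo y ⊎ hi y ≤ lo x) xs →
  All (λ x → hi x ≤ N) xs →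
  All (λ x → ∀ {k} → lo x ≤ k → k < hi x → P k) xs →
  sum (map (λ x → hi x ∸ lo x) xs) ≤ length (filter P? (upTo N))
sum-widths-≤-length-filter lo hi P? [] _ _ _ = z≤n
sum-widths-≤-length-filter lo hi {P} P? {N} (x ∷ xs) (sep ∷ seps) (x≤N ∷ xs≤N) (x⊆P ∷ xs⊆P) = begin
  hi x ∸ lo x + sum (map (λ x → hi x ∸ lo x) xs)               ≤⟨ +-mono-≤ count-x rest ⟩
  length (filter In? (upTo N)) + length (filter P∖In? (upTo N)) ≤⟨ split ⟩
  length (filter P? (upTo N))                                   ∎
  where
  open ≤-Reasoning
  In? = λ k → (lo x ℕ.≤? k) ×-dec (k ℕ.<? hi x)
  P∖In? = λ k → P? k ×-dec ¬? (In? k)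
  outside : ∀ {y} → hi x ≤ lo y ⊎ hi y ≤ lo x →
            ∀ {k} → lo y ≤ k → k < hi y → ¬ (lo x ≤ k × k < hi x)
  outside (inj₁ hx≤ly) ly≤k _    (_ , k<hx)    = <⇒≱ k<hx (≤-trans hx≤ly ly≤k)
  outside (inj₂ hy≤lx) _    k<hy (lx≤k , _)    = <⇒≱ k<hy (≤-trans hy≤lx lx≤k)
  count-x = interval-≤-length-filter In? (lo x) (hi x) x≤N _,_
  rest = sum-widths-≤-length-filter lo hi P∖In? xs seps xs≤N
    (All.zipWith (λ { (s , y⊆P) {_} ly≤k k<hy → y⊆P ly≤k k<hy , outside s ly≤k k<hy }) (sep , xs⊆P))
  split = length-filter-disjoint-≤ P? In? P∖In? (λ (lx≤k , k<hx) → x⊆P lx≤k k<hx) proj₁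
    (λ (in-x , _ , ¬in-x) → ¬in-x in-x) (upTo N)

ascending-head-length-*-< : ∀ {N B a} l → AllPairs _<_ (a ∷ l) → All (λ e → e * N < B) (a ∷ l) →
                            a * N + length l * N < B
ascending-head-length-*-< {N} {B} {a} [] _ (aN<B ∷ _) = subst (_< B) (sym (+-identityʳ (a * N))) aN<B
ascending-head-length-*-< {N} {B} {a} (b ∷ l) ((a<b ∷ _) ∷ b<l) (_ ∷ bounds) = begin-strict
  a * N + (N + length l * N) ≡⟨ +-assoc (a * N) N (length l * N) ⟨
  a * N + N + length l * N   ≤⟨ +-monoˡ-≤ (length l * N) aN+N≤bN ⟩
  b * N + length l * N       <⟨ ascending-head-length-*-< l b<l bounds ⟩
  B                          ∎
  where
  open ≤-Reasoning
  aN+N≤bN : a * N + N ≤ b * N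
  aN+N≤bN = subst (_≤ b * N) (+-comm N (a * N)) (*-monoˡ-≤ N a<b)

ascending-length-*-≤ : ∀ {N A B} l → AllPairs _<_ l → All (λ e → A < e * N × e * N < B) l →
                       length l * N ≤ B ∸ A + N
ascending-length-*-≤ [] _ _ = z≤n
ascending-length-*-≤ {N} {A} {B} (a ∷ l) asc bounds@((A<aN , _) ∷ _) = begin
  N + length l * N ≤⟨ +-monoʳ-≤ N (m+n≤o⇒m≤o∸n (length l * N) lN+A≤B) ⟩
  N + (B ∸ A)      ≡⟨ +-comm N (B ∸ A) ⟩
  B ∸ A + N        ∎
  where
  open ≤-Reasoning
  lN+A≤B : length l * N + A ≤ B
  lN+A≤B = begin
    length l * N + A     ≡⟨ +-comm (length l * N) A ⟩
    A + length l * N     ≤⟨ +-monoˡ-≤ (length l * N) (<⇒≤ A<aN) ⟩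
    a * N + length l * N ≤⟨ <⇒≤ (ascending-head-length-*-< l asc (All.map proj₂ bounds)) ⟩
    B                    ∎

sum-*-≤-*-sum : ∀ {A : Set} {f : A → ℕ} {n} c (g : A → ℕ) xs → All (λ x → f x * n ≤ c * g x) xs →
                sum (map f xs) * n ≤ c * sum (map g xs)
sum-*-≤-*-sum c g [] [] = z≤n
sum-*-≤-*-sum {f = f} {n} c g (x ∷ xs) (fx≤gx ∷ rest) = begin
  (f x + sum (map f xs)) * n    ≡⟨ *-distribʳ-+ n (f x) _ ⟩
  f x * n + sum (map f xs) * n  ≤⟨ +-mono-≤ fx≤gx (sum-*-≤-*-sum c g xs rest) ⟩
  c * g x + c * sum (map g xs)  ≡⟨ *-distribˡ-+ c (g x) _ ⟨
  c * (g x + sum (map g xs))    ∎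
  where open ≤-Reasoning

module FareyCells (m d N : ℕ) .{{_ : NonZero d}} .{{_ : NonZero N}} (mm≤d : m * m ≤ d)
                  (nxt : ℚ → ℚ) (nxt-succ : IsFareySuccessor m nxt) where
  open Grid N

  width : ℚ → ℕ
  width x = numerAt (nxt x) ∸ numerAt x

  record Cell (x : ℚ) : Set where
    field
      x∈𝓕ₘ   : InFarey m x
      x≢1    : x ≢ 1ℚ
      ↧x∣N   : ↧ₙ x ∣ N
      ↧nxt∣N : ↧ₙ (nxt x) ∣ N

  module _ {x : ℚ} (cell : Cell x) where
    open Cell cell

    private
      nxt∈𝓕ₘ : InFarey m (nxt x)
      nxt∈𝓕ₘ = proj₁ (nxt-succ x x∈𝓕ₘ x≢1)

      x<nxt : x ℚ.< nxt x
      x<nxt = proj₁ (proj₂ (nxt-succ x x∈𝓕ₘ x≢1))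

    nothing-between : ∀ y → InFarey m y → x ℚ.< y → ¬ (y ℚ.< nxt x)
    nothing-between = proj₂ (proj₂ (nxt-succ x x∈𝓕ₘ x≢1))

    x-on-grid : OnGrid x
    x-on-grid = proj₁ x∈𝓕ₘ , ↧x∣N

    nxt-on-grid : OnGrid (nxt x)
    nxt-on-grid = proj₁ nxt∈𝓕ₘ , ↧nxt∣N

    numerAt-nxt-≤N : numerAt (nxt x) ≤ N
    numerAt-nxt-≤N = subst (numerAt (nxt x) ≤_) numerAt-1ℚ
      (numerAt-mono-≤ nxt-on-grid (ℚP.nonNegative⁻¹ 1ℚ , 1∣ N) (proj₁ (proj₂ nxt∈𝓕ₘ)))

    N≤width*d : N ≤ width x * d
    N≤width*d = ≤-trans (numerAt-gap x-on-grid nxt-on-grid x<nxt)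
      (*-monoʳ-≤ (width x) (≤-trans (*-mono-≤ ↧x≤m ↧nxt≤m) mm≤d))
      where
      ↧x≤m = proj₂ (proj₂ x∈𝓕ₘ)
      ↧nxt≤m = proj₂ (proj₂ nxt∈𝓕ₘ)

    countUnits-*N-≤ : countUnits d x (nxt x) * N ≤ 2 * d * width x
    countUnits-*N-≤ = begin
      length units * N                         ≤⟨ ascending-length-*-≤ units ascending bounds ⟩
      numerAt (nxt x) * d ∸ numerAt x * d + N  ≡⟨ cong (_+ N) (*-distribʳ-∸ d _ (numerAt x)) ⟨
      w * d + N                                ≤⟨ +-monoʳ-≤ (w * d) N≤width*d ⟩
      w * d + w * d                            ≡⟨ cong (_+_ (w * d)) (+-identityʳ (w * d)) ⟨
      2 * (w * d)                              ≡⟨ cong (2 *_) (*-comm w d) ⟩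
      2 * (d * w)                              ≡⟨ *-assoc 2 d w ⟨
      2 * d * w                                ∎
      where
      open ≤-Reasoning
      w = width x
      unit? = λ a → coprime? a d ×-dec ((x <? (a ÷ d)) ×-dec ((a ÷ d) <? nxt x))
      units = filter unit? (map suc (upTo d))
      ascending : AllPairs _<_ units
      ascending = AllPairsP.filter⁺ unit?
        (AllPairsP.map⁺ (AllPairsP.applyUpTo⁺₁ (λ i → i) d (λ i<j _ → s≤s i<j)))
      bounds : All (λ a → numerAt x * d < a * N × a * N < numerAt (nxt x) * d) units
      bounds = All.map (λ (_ , x<a/d , a/d<nxt) →
          ÷-<⇒cross-< (subst (ℚ._< _) (≡numerAt÷N x-on-grid) x<a/d)
        , ÷-<⇒cross-< (subst (_ ℚ.<_) (≡numerAt÷N nxt-on-grid) a/d<nxt))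
        (AllP.all-filter unit? (map suc (upTo d)))

  numerAt-nxt-≤ : ∀ {x y} → Cell x → Cell y → x ℚ.< y → numerAt (nxt x) ≤ numerAt y
  numerAt-nxt-≤ {x} {y} x-cell y-cell x<y = numerAt-mono-≤ (nxt-on-grid x-cell) (x-on-grid y-cell)
    (ℚP.≮⇒≥ (nothing-between x-cell y (Cell.x∈𝓕ₘ y-cell) x<y))

  cells-separated : ∀ {x y} → Cell x → Cell y → x ≢ y →
                    numerAt (nxt x) ≤ numerAt y ⊎ numerAt (nxt y) ≤ numerAt x
  cells-separated {x} {y} x-cell y-cell x≢y with ℚP.<-cmp x y
  ... | tri< x<y _ _ = inj₁ (numerAt-nxt-≤ x-cell y-cell x<y)
  ... | tri≈ _ x≡y _ = ⊥-elim (x≢y x≡y)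
  ... | tri> _ _ y<x = inj₂ (numerAt-nxt-≤ y-cell x-cell y<x)

  cells-pairwise-separated : ∀ {xs} → All Cell xs → Unique xs →
    AllPairs (λ x y → numerAt (nxt x) ≤ numerAt y ⊎ numerAt (nxt y) ≤ numerAt x) xs
  cells-pairwise-separated [] [] = []
  cells-pairwise-separated (x-cell ∷ cells) (x∉xs ∷ unique) =
    All.zipWith (λ (y-cell , x≢y) → cells-separated x-cell y-cell x≢y) (cells , x∉xs)
    ∷ cells-pairwise-separated cells unique

  sum-width-≤-length-filter : ∀ {P : Pred ℕ 0ℓ} (P? : Decidable P) {xs} → All Cell xs → Unique xs →
    (∀ {x} k → x ∈ xs → x ℚ.≤ midpoint k → midpoint k ℚ.≤ nxt x → P k) →
    sum (map width xs) ≤ length (filter P? (upTo N))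
  sum-width-≤-length-filter P? {xs} cells unique P-on-cells =
    sum-widths-≤-length-filter numerAt (λ x → numerAt (nxt x)) P? xs
      (cells-pairwise-separated cells unique)
      (All.map numerAt-nxt-≤N cells)
      (All.tabulate (λ x∈xs {k} gx≤k k<gnxt → let x-cell = All.lookup cells x∈xs in
        P-on-cells k x∈xs (≤-midpoint (x-on-grid x-cell) gx≤k) (midpoint-≤ (nxt-on-grid x-cell) k<gnxt)))

gridSize-nonZero : ∀ ivs → NonZero (gridSize ivs)
gridSize-nonZero ivs = product≢0 (AllP.map⁺ (All.universal (λ (a , b) → m*n≢0 (↧ₙ a) (↧ₙ b)) ivs))

↧*↧∣gridSize : ∀ {a b ivs} → (a , b) ∈ ivs → ↧ₙ a * ↧ₙ b ∣ gridSize ivs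
↧*↧∣gridSize a,b∈ivs = ∈⇒∣product (∈-map⁺ _ a,b∈ivs)

proposition3p12 : (m d : ℕ) → 1 ℕ.≤ m → 1 ℕ.≤ d → m ℕ.* m ℕ.≤ d →
    (nxt : ℚ → ℚ) → IsFareySuccessor m nxt →
    (U : List ℚ) → Unique U → All (λ x → InFarey m x × x ≢ 1ℚ) U →
    (sum (map (λ x → countUnits d x (nxt x)) U) ÷ 1)
      ℚ.≤ ((2 ℕ.* d) ÷ 1) ℚ.* measureUnion (map (λ x → (x , nxt x)) U)
proposition3p12 m d _ 1≤d mm≤d nxt nxt-succ U unique U⊆𝓕ₘ =
  subst (S ÷ 1 ℚ.≤_) (sym (÷1-*-÷ (2 * d) C N)) (cross-≤⇒÷-≤ {S} {1} {2 * d * C} {N} (begin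
    S * N                     ≤⟨ sum-*-≤-*-sum (2 * d) width U (All.map countUnits-*N-≤ cells) ⟩
    2 * d * sum (map width U) ≤⟨ *-monoʳ-≤ (2 * d) (sum-width-≤-length-filter covered? cells unique covers) ⟩
    2 * d * C                 ≡⟨ *-identityʳ (2 * d * C) ⟨
    2 * d * C * 1             ∎))
  where
  open ≤-Reasoning
  ivs = map (λ x → (x , nxt x)) U
  N = gridSize ivs
  instance
    N≢0 : NonZero N
    N≢0 = gridSize-nonZero ivs
    d≢0 : NonZero d
    d≢0 = >-nonZero 1≤d
  open Grid N
  open FareyCells m d N mm≤d nxt nxt-succ
  -- the predicate counted by measureUnion, so that measureUnion ivs unfolds to C ÷ N
  covered? = λ k → Any.any? (λ iv → (proj₁ iv ≤? midpoint k) ×-dec (midpoint k ≤? proj₂ iv)) ivs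
  S = sum (map (λ x → countUnits d x (nxt x)) U)
  C = length (filter covered? (upTo N))
  cells : All Cell U
  cells = All.tabulate (λ {x} x∈U → record
    { x∈𝓕ₘ   = proj₁ (All.lookup U⊆𝓕ₘ x∈U)
    ; x≢1    = proj₂ (All.lookup U⊆𝓕ₘ x∈U)
    ; ↧x∣N   = ∣-trans (m∣m*n (↧ₙ (nxt x))) (↧*↧∣gridSize (∈-map⁺ _ x∈U))
    ; ↧nxt∣N = ∣-trans (n∣m*n (↧ₙ x)) (↧*↧∣gridSize (∈-map⁺ _ x∈U))
    })
  covers : ∀ {x} k → x ∈ U → x ℚ.≤ midpoint k → midpoint k ℚ.≤ nxt x →
           Any (λ iv → proj₁ iv ℚ.≤ midpoint k × midpoint k ℚ.≤ proj₂ iv) ivs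
  covers _ x∈U x≤mid mid≤nxt = lose (∈-map⁺ _ x∈U) (x≤mid , mid≤nxt)
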